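{- For all natural numbers $d,j,c$, $M_{d+2}^0(j+c)\ge M_d^0(j)^{c+1}$.
   Context: $K$ is a field. A monomial in $K[X_d,\dots,X_0,Y]$ is a polynomial $X_d^{i_d}\cdots X_0^{i_0}Y^j$, of degree $i_d+\dots+i_0+j$. A monomial ideal is an ideal generated by monomials; the degree of a finite set of monomials is the maximum degree of its elements, and $\mathrm{deg}(I)$ for a monomial ideal $I$ is the minimum degree of a finite set of monomials generating $I$. For natural numbers $d,l$, $M_d^0(l)$ denotes the least $M$ such that for every sequence $I_0,\dots,I_M$ of monomial ideals in $K[X_d,\dots,X_0,Y]$ with $\mathrm{deg}(I_i)\le l$ for all $i\le M$ there exist $i<j\le M$ with $I_i\supseteq I_j$. -}

module Defs where

open import Data.Nat using (ℕ; suc; _≤_; _<_)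
open import Data.Fin using (Fin) renaming (_<_ to _<ᶠ_)
open import Data.Vec using (Vec; sum)
open import Data.Vec.Relation.Binary.Pointwise.Inductive using (Pointwise)
open import Data.List using (List)
open import Data.List.Relation.Unary.Any using (Any)
open import Data.List.Relation.Unary.All using (All)
open import Data.Product using (Σ; _×_; ∃₂)

-- Number of variables of K[X_d,…,X_0,Y]: d + 2.
NVars : ℕ → ℕ
NVars d = suc (suc d)

-- A monomial X_d^{i_d}⋯X_0^{i_0}Y^j, represented by its exponent vector.
Monomial : ℕ → Set
Monomial d = Vec ℕ (NVars d)

deg : ∀ {d} → Monomial d → ℕ
deg m = sum m

_∣ᵐ_ : ∀ {d} → Monomial d → Monomial d → Set
g ∣ᵐ m = Pointwise _≤_ g m

Generators : ℕ → Set
Generators d = List (Monomial d)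

_∈ᴵ_ : ∀ {d} → Monomial d → Generators d → Set
m ∈ᴵ G = Any (λ g → g ∣ᵐ m) G

-- ideal containment ⟨G⟩ ⊇ ⟨H⟩ (monomial ideals are determined by their monomials)
_⊇ᴵ_ : ∀ {d} → Generators d → Generators d → Set
G ⊇ᴵ H = ∀ m → m ∈ᴵ H → m ∈ᴵ G

DegAtMost : ∀ {d} → ℕ → Generators d → Set
DegAtMost l G = All (λ g → deg g ≤ l) G

-- M is "good" for (d,l): every sequence I_0,…,I_M of monomial ideals of degree ≤ l
-- in K[X_d,…,X_0,Y] has i < j ≤ M with I_i ⊇ I_j.
-- (deg(I) ≤ l iff I has some generating set of degree ≤ l.)
Good : ℕ → ℕ → ℕ → Set
Good d l M = (I : Fin (suc M) → Generators d) → (∀ i → DegAtMost l (I i)) →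
  ∃₂ λ i j → i <ᶠ j × I i ⊇ᴵ I j

IsM0 : ℕ → ℕ → ℕ → Set
IsM0 d l N = Good d l N × (∀ M → Good d l M → N ≤ M)

-- Let J₀, …, J_{N-1} be a bad sequence for M_d^0(j), i.e. no Jᵢ ⊇ Jᵢ' with i < i'.
-- Read t < N^(c+1) as its base-N digits x₀ … x_c and put
-- I_t = Σᵢ Uⁱ V^(c-i) J_{xᵢ} in two new variables U, V; it has degree ≤ j + c.
-- The monomials Uⁱ V^(c-i) form an antichain, so I_t ⊇ I_t' forces J_{xᵢ} ⊇ J_{x'ᵢ}
-- layer by layer; badness of J then gives x'ᵢ ≤ xᵢ for every i, hence t' ≤ t.
-- So I_0, …, I_{N^(c+1)-1} is a bad sequence.
module Submission where

open import Defs
open import Data.Nat using (ℕ; suc; _+_; _^_; _≤_)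
open import Data.Nat using (zero; _*_; _∸_; _<_; z≤n)
open import Data.Nat.Properties
open import Data.Fin as Fin using (Fin; toℕ; inject≤; combine; funToFin; finToFun)
  renaming (_<_ to _<ᶠ_; _≤_ to _≤ᶠ_)
open import Data.Fin.Properties using (toℕ-inject≤; toℕ-combine; funToFin-finToFin; any?)
  renaming (_<?_ to _<ᶠ?_)
open import Data.Vec using (_∷_)
open import Data.Vec.Relation.Binary.Pointwise.Inductive using (_∷_)
open import Data.List using (map; _++_; _∷_)
open import Data.List.Relation.Unary.Any as Any using (here; there)
import Data.List.Relation.Unary.Any.Properties as Any
import Data.List.Relation.Unary.All as All
import Data.List.Relation.Unary.All.Properties as All
open import Data.Product using (_×_; _,_; proj₁; proj₂; ∃; ∃₂; map₂)
open import Data.Sum using (inj₁; inj₂)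
open import Function using (_∘_)
open import Relation.Nullary using (yes; no; contradiction)
open import Relation.Binary.PropositionalEquality using (sym; subst; subst₂)

shift : ∀ {d} → ℕ → ℕ → Generators d → Generators (suc (suc d))
shift a b = map (λ g → a ∷ b ∷ g)

shift-∈ᴵ⁺ : ∀ {d a b p q} {g : Monomial d} {G} →
  a ≤ p → b ≤ q → g ∈ᴵ G → (p ∷ q ∷ g) ∈ᴵ shift a b G
shift-∈ᴵ⁺ a≤p b≤q g∈G = Any.map⁺ (Any.map (λ h∣g → a≤p ∷ b≤q ∷ h∣g) g∈G)

shift-∈ᴵ⁻ : ∀ {d a b p q} {g : Monomial d} {G} →
  (p ∷ q ∷ g) ∈ᴵ shift a b G → a ≤ p × b ≤ q × g ∈ᴵ G
shift-∈ᴵ⁻ {G = _ ∷ _} (here (a≤p ∷ b≤q ∷ h∣g)) = a≤p , b≤q , here h∣g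
shift-∈ᴵ⁻ {G = _ ∷ _} (there m∈G)                = map₂ (map₂ there) (shift-∈ᴵ⁻ m∈G)

shift-deg : ∀ {d j} a b {G : Generators d} → DegAtMost j G → DegAtMost (a + (b + j)) (shift a b G)
shift-deg a b G-deg = All.map⁺ (All.map (+-monoʳ-≤ a ∘ +-monoʳ-≤ b) G-deg)

staircase : ∀ {d b} → ℕ → (Fin (suc b) → Generators d) → Generators (suc (suc d))
staircase {b = zero}  a G = shift a zero (G Fin.zero)
staircase {b = suc b} a G = shift a (suc b) (G Fin.zero) ++ staircase (suc a) (G ∘ Fin.suc)

staircase-deg : ∀ {d j b} a (G : Fin (suc b) → Generators d) →
  (∀ i → DegAtMost j (G i)) → DegAtMost (a + (b + j)) (staircase a G)
staircase-deg {b = zero}  a G G-deg = shift-deg a zero (G-deg Fin.zero)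
staircase-deg {j = j} {b = suc b} a G G-deg = All.++⁺ (shift-deg a (suc b) (G-deg Fin.zero))
  (subst (λ l → DegAtMost l (staircase (suc a) (G ∘ Fin.suc))) (sym (+-suc a (b + j)))
    (staircase-deg (suc a) (G ∘ Fin.suc) (G-deg ∘ Fin.suc)))

staircase-∈ᴵ-bound : ∀ {d b p q} a (G : Fin (suc b) → Generators d) {g : Monomial d} →
  (p ∷ q ∷ g) ∈ᴵ staircase a G → a ≤ p
staircase-∈ᴵ-bound {b = zero}  a G m∈ = proj₁ (shift-∈ᴵ⁻ m∈)
staircase-∈ᴵ-bound {b = suc b} a G m∈ with Any.++⁻ (shift a (suc b) (G Fin.zero)) m∈
... | inj₁ m∈G₀ = proj₁ (shift-∈ᴵ⁻ m∈G₀)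
... | inj₂ m∈Gₛ = ≤-trans (n≤1+n a) (staircase-∈ᴵ-bound (suc a) (G ∘ Fin.suc) m∈Gₛ)

staircase-∈ᴵ⁺ : ∀ {d b} a (G : Fin (suc b) → Generators d) i {g} →
  g ∈ᴵ G i → (a + toℕ i ∷ b ∸ toℕ i ∷ g) ∈ᴵ staircase a G
staircase-∈ᴵ⁺ {b = zero}  a G Fin.zero g∈ = shift-∈ᴵ⁺ (m≤m+n a 0) ≤-refl g∈
staircase-∈ᴵ⁺ {b = suc b} a G Fin.zero g∈ = Any.++⁺ˡ (shift-∈ᴵ⁺ (m≤m+n a 0) ≤-refl g∈)
staircase-∈ᴵ⁺ {b = suc b} a G (Fin.suc i) {g} g∈ = Any.++⁺ʳ (shift a (suc b) (G Fin.zero))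
  (subst (λ p → (p ∷ b ∸ toℕ i ∷ g) ∈ᴵ staircase (suc a) (G ∘ Fin.suc))
    (sym (+-suc a (toℕ i))) (staircase-∈ᴵ⁺ (suc a) (G ∘ Fin.suc) i g∈))

-- The layer is read off from the two new exponents: deeper layers have a larger
-- first exponent, shallower ones a larger second exponent.
staircase-∈ᴵ⁻ : ∀ {d b} a (G : Fin (suc b) → Generators d) i {g} →
  (a + toℕ i ∷ b ∸ toℕ i ∷ g) ∈ᴵ staircase a G → g ∈ᴵ G i
staircase-∈ᴵ⁻ {b = zero}  a G Fin.zero m∈ = proj₂ (proj₂ (shift-∈ᴵ⁻ m∈))
staircase-∈ᴵ⁻ {b = suc b} a G Fin.zero m∈ with Any.++⁻ (shift a (suc b) (G Fin.zero)) m∈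
... | inj₁ m∈G₀ = proj₂ (proj₂ (shift-∈ᴵ⁻ m∈G₀))
... | inj₂ m∈Gₛ = contradiction
  (≤-trans (staircase-∈ᴵ-bound (suc a) (G ∘ Fin.suc) m∈Gₛ) (≤-reflexive (+-identityʳ a))) (n≮n a)
staircase-∈ᴵ⁻ {b = suc b} a G (Fin.suc i) {g} m∈ with Any.++⁻ (shift a (suc b) (G Fin.zero)) m∈
... | inj₁ m∈G₀ = contradiction (≤-trans (proj₁ (proj₂ (shift-∈ᴵ⁻ m∈G₀))) (m∸n≤m b (toℕ i))) (n≮n b)
... | inj₂ m∈Gₛ = staircase-∈ᴵ⁻ (suc a) (G ∘ Fin.suc) i
  (subst (λ p → (p ∷ b ∸ toℕ i ∷ g) ∈ᴵ staircase (suc a) (G ∘ Fin.suc)) (+-suc a (toℕ i)) m∈Gₛ)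

staircase-⊇ᴵ⁻ : ∀ {d b a} {G H : Fin (suc b) → Generators d} →
  staircase a G ⊇ᴵ staircase a H → ∀ i → G i ⊇ᴵ H i
staircase-⊇ᴵ⁻ {a = a} {G} {H} G⊇H i g g∈Hᵢ =
  staircase-∈ᴵ⁻ a G i (G⊇H _ (staircase-∈ᴵ⁺ a H i g∈Hᵢ))

funToFin-mono : ∀ {k n} {f g : Fin k → Fin n} → (∀ i → f i ≤ᶠ g i) → funToFin f ≤ᶠ funToFin g
funToFin-mono {zero}      f≤g = z≤n
funToFin-mono {suc k} {n} {f} {g} f≤g = begin
  toℕ (combine (f Fin.zero) (funToFin (f ∘ Fin.suc)))
    ≡⟨ toℕ-combine (f Fin.zero) _ ⟩
  n ^ k * toℕ (f Fin.zero) + toℕ (funToFin (f ∘ Fin.suc))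
    ≤⟨ +-mono-≤ (*-monoʳ-≤ (n ^ k) (f≤g Fin.zero)) (funToFin-mono (f≤g ∘ Fin.suc)) ⟩
  n ^ k * toℕ (g Fin.zero) + toℕ (funToFin (g ∘ Fin.suc))
    ≡⟨ toℕ-combine (g Fin.zero) _ ⟨
  toℕ (combine (g Fin.zero) (funToFin (g ∘ Fin.suc))) ∎
  where open ≤-Reasoning

finToFun-<-witness : ∀ {n k} {t t' : Fin (n ^ k)} → t <ᶠ t' →
  ∃ λ i → finToFun {n} {k} t i <ᶠ finToFun {n} {k} t' i
finToFun-<-witness {n} {k} {t} {t'} t<t'
  with any? (λ i → finToFun {n} {k} t i <ᶠ? finToFun {n} {k} t' i)
... | yes witness = witness
... | no none = contradiction t<t' (≤⇒≯ (subst₂ _≤ᶠ_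
        (funToFin-finToFin {k} {n} t') (funToFin-finToFin {k} {n} t)
        (funToFin-mono {k} {n} (λ i → ≮⇒≥ (λ lt → none (i , lt))))))

Good-lift : ∀ {d j} c n M → M < suc n ^ suc c → Good (suc (suc d)) (j + c) M → Good d j n
Good-lift {d} {j} c n M M<Nᶜ⁺¹ good J J-deg = bad-pair (good I I-deg)
  where
    word : Fin (suc M) → Fin (suc c) → Fin (suc n)
    word t = finToFun {suc n} {suc c} (inject≤ t M<Nᶜ⁺¹)

    inject< : ∀ {t t'} → t <ᶠ t' → inject≤ t M<Nᶜ⁺¹ <ᶠ inject≤ t' M<Nᶜ⁺¹
    inject< {t} {t'} = subst₂ _<_ (sym (toℕ-inject≤ t M<Nᶜ⁺¹)) (sym (toℕ-inject≤ t' M<Nᶜ⁺¹))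

    I : Fin (suc M) → Generators (suc (suc d))
    I t = staircase 0 (J ∘ word t)

    I-deg : ∀ t → DegAtMost (j + c) (I t)
    I-deg t = subst (λ l → DegAtMost l (I t)) (+-comm c j)
      (staircase-deg 0 (J ∘ word t) (J-deg ∘ word t))

    bad-pair : (∃₂ λ t t' → t <ᶠ t' × I t ⊇ᴵ I t') → ∃₂ λ x x' → x <ᶠ x' × J x ⊇ᴵ J x'
    bad-pair (t , t' , t<t' , Iₜ⊇Iₜ') =
      let (i , xᵢ<x'ᵢ) = finToFun-<-witness (inject< t<t')
      in word t i , word t' i , xᵢ<x'ᵢ , staircase-⊇ᴵ⁻ Iₜ⊇Iₜ' i

mainTheorem7 : (d j c N M : ℕ) → IsM0 d j N → IsM0 (d + 2) (j + c) M →
    N ^ (suc c) ≤ M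
mainTheorem7 d j c zero    M _ _ = z≤n
mainTheorem7 d j c (suc n) M (_ , N-least) (M-good , _) = ≮⇒≥ λ M<Nᶜ⁺¹ →
  n≮n n (N-least n (Good-lift c n M M<Nᶜ⁺¹ (subst (λ e → Good e (j + c) M) (+-comm d 2) M-good)))
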